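{- Let $G$ be a complete tiered graph with vertices labelled $1,\dots,n$, let $T$ be a spanning tree of $G$, and let $T_{\mathbf{act}}$ be the graph obtained from $T$ by adding all externally active edges. Then the elements $Z_{G\setminus T_{\mathbf{act}}}$, where $G\setminus T_{\mathbf{act}}$ is the graph obtained by removing the subgraph $T_{\mathbf{act}}$ from $G$, span the space $\mathcal{S}_G$.
   Context: A tiered graph is a simple graph $G=(V,E)$ with vertices labelled $1,\dots,n$ and a surjective tiering function $\mathbf{t}:V\to[m]$, $m\le n$, such that if $(i,j)\in E$ with $i<j$ then $\mathbf{t}(i)<\mathbf{t}(j)$. It is complete if $(i,j)$ is an edge whenever $i<j$ and $\mathbf{t}(i)<\mathbf{t}(j)$. Edges are ordered lexicographically. For a spanning tree $T$, an edge $e\notin T$ is externally active if it is the minimal edge of the unique cycle in $T\cup\{e\}$. Over a field $\mathbb K$, for a subgraph $H$ of $G$ put $Z_H=\prod_{e\in H}z_e\in\mathbb K[z_1,\dots,z_n]$, where $z_e=z_i-z_j$ for $e=(i,j)$ with $i<j$, $\mathbf{t}(i)<\mathbf{t}(j)$. A subgraph $H$ of $G$ is slim if $G\setminus H$ (remove the edges of $H$) is connected. The space $\mathcal{S}_G\subseteq\mathbb K[z_1,\dots,z_n]$ is the linear span of the elements $Z_H$ for $H$ ranging over slim subgraphs of $G$. -}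

module Defs where

open import Level using (Level; _⊔_; suc)
open import Algebra.Bundles using (CommutativeRing)
open import Data.Nat as ℕ using (ℕ)
import Data.Nat.Properties as ℕP
open import Data.Fin as Fin using (Fin; _<_)
import Data.Fin.Properties as FinP
open import Data.Vec as Vec using (Vec; replicate; zipWith; updateAt)
import Data.Vec.Properties as VecP
open import Data.List as List using (List; []; _∷_; _++_; allFin; concatMap; map; foldr; length)
open import Data.List.Relation.Unary.Linked using (Linked)
open import Data.List.Relation.Unary.Unique.Propositional using (Unique)
open import Data.Bool using (Bool; true; false; _∧_; if_then_else_)
open import Data.Product using (Σ; ∃; _×_; _,_; proj₁)
open import Data.Sum using (_⊎_)
open import Relation.Nullary using (¬_; Dec; yes; no; does)
open import Relation.Binary.PropositionalEquality using (_≡_)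

record Field (c ℓ : Level) : Set (suc (c ⊔ ℓ)) where
  field
    commutativeRing : CommutativeRing c ℓ
  open CommutativeRing commutativeRing public
  field
    0≉1     : ¬ (0# ≈ 1#)
    inverse : ∀ x → ¬ (x ≈ 0#) → ∃ λ y → x * y ≈ 1#

-- The polynomial ring K[z_0,…,z_{n-1}], concretely.
-- A polynomial is a finite formal sum of terms c·z^α (α : Vec ℕ n);
-- two polynomials are equal iff all their monomial coefficients agree.

module Poly {c ℓ} (K : Field c ℓ) (n : ℕ) where
  open Field K

  Monomial : Set
  Monomial = Vec ℕ n

  Pol : Set c
  Pol = List (Carrier × Monomial)

  coeff : Pol → Monomial → Carrier
  coeff []             α = 0#
  coeff ((a , β) ∷ p) α = if does (VecP.≡-dec ℕP._≟_ β α) then a + coeff p α else coeff p α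

  infix 4 _≈P_
  _≈P_ : Pol → Pol → Set ℓ
  p ≈P q = ∀ α → coeff p α ≈ coeff q α

  0P : Pol
  0P = []

  1P : Pol
  1P = (1# , replicate n 0) ∷ []

  _+P_ : Pol → Pol → Pol
  p +P q = p ++ q

  _*P_ : Pol → Pol → Pol
  p *P q = concatMap (λ { (a , α) → map (λ { (b , β) → (a * b , zipWith ℕ._+_ α β) }) q }) p

  _·P_ : Carrier → Pol → Pol
  k ·P p = map (λ { (a , α) → (k * a , α) }) p

  var : Fin n → Pol
  var i = (1# , updateAt (replicate n 0) i (λ _ → 1)) ∷ []

  varDiff : Fin n → Fin n → Pol
  varDiff i j = var i +P ((- 1#) ·P var j)

  linComb : ∀ {i} {I : Set i} → (I → Pol) → List (Carrier × I) → Pol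
  linComb f = foldr (λ { (k , x) acc → (k ·P f x) +P acc }) 0P

  InSpan : ∀ {i} (I : Set i) → (I → Pol) → Pol → Set (c ⊔ ℓ ⊔ i)
  InSpan I f p = Σ (List (Carrier × I)) λ cs → linComb f cs ≈P p

-- Complete tiered graphs on vertex set Fin n (labels 0..n-1) with
-- tiering t : Fin n → Fin m.

module Tiered {n m : ℕ} (t : Fin n → Fin m) where

  IsEdge : Fin n → Fin n → Set
  IsEdge i j = (i < j) × (t i < t j)

  isEdge? : (i j : Fin n) → Bool
  isEdge? i j = does (i Fin.<? j) ∧ does (t i Fin.<? t j)

  -- A subgraph (on the full vertex set) is given by a Boolean on ordered
  -- pairs; only pairs that are edges of G are considered, i.e. the edge set
  -- of H is { (i , j) | IsEdge i j and H i j ≡ true }.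
  Subgraph : Set
  Subgraph = Fin n → Fin n → Bool

  InComplement : Subgraph → Fin n → Fin n → Set
  InComplement H i j = IsEdge i j × H i j ≡ false

  InSub : Subgraph → Fin n → Fin n → Set
  InSub H i j = IsEdge i j × H i j ≡ true

  Adj : (Fin n → Fin n → Set) → Fin n → Fin n → Set
  Adj E u v = E u v ⊎ E v u

  endsAt : Fin n → List (Fin n) → Fin n
  endsAt u []       = u
  endsAt u (x ∷ xs) = endsAt x xs

  Walk : (Fin n → Fin n → Set) → Fin n → Fin n → Set
  Walk R u v = Σ (List (Fin n)) λ xs → Linked R (u ∷ xs) × endsAt u xs ≡ v

  SimplePath : (Fin n → Fin n → Set) → Fin n → Fin n → Set
  SimplePath R u v = Σ (List (Fin n)) λ xs →
    Linked R (u ∷ xs) × Unique (u ∷ xs) × endsAt u xs ≡ v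

  Connected : (Fin n → Fin n → Set) → Set
  Connected E = ∀ u v → Walk (Adj E) u v

  Cycle : (Fin n → Fin n → Set) → Set
  Cycle E = Σ (Fin n) λ u → Σ (List (Fin n)) λ xs →
    Linked (Adj E) (u ∷ xs) × Unique (u ∷ xs) × 2 ℕ.≤ length xs
      × Adj E (endsAt u xs) u

  Acyclic : (Fin n → Fin n → Set) → Set
  Acyclic E = ¬ Cycle E

  record SpanningTree : Set where
    field
      tree      : Subgraph
      connected : Connected (InSub tree)
      acyclic   : Acyclic (InSub tree)

  LexLt : (Fin n × Fin n) → (Fin n × Fin n) → Set
  LexLt (i , j) (k , l) = (i < k) ⊎ ((i ≡ k) × (j < l))

  EdgeAbove : Fin n → Fin n → Fin n → Fin n → Set
  EdgeAbove i j a b = ((a < b) × LexLt (i , j) (a , b)) ⊎ ((b < a) × LexLt (i , j) (b , a))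

  -- e = (i , j) ∉ T is externally active: it is the minimal edge of the
  -- cycle formed by e and the (unique) path in T from i to j, i.e. every
  -- edge of that path is lexicographically larger than e.
  ExternallyActive : SpanningTree → Fin n → Fin n → Set
  ExternallyActive T i j =
    IsEdge i j × SpanningTree.tree T i j ≡ false ×
    SimplePath (λ a b → Adj (InSub (SpanningTree.tree T)) a b × EdgeAbove i j a b) i j

  -- S represents G \ T_act, where T_act = T ∪ {externally active edges}
  IsComplementOfTact : SpanningTree → Subgraph → Set
  IsComplementOfTact T S = ∀ i j →
    (S i j ≡ true → IsEdge i j × SpanningTree.tree T i j ≡ false × ¬ ExternallyActive T i j)
    × (IsEdge i j × SpanningTree.tree T i j ≡ false × ¬ ExternallyActive T i j → S i j ≡ true)

  Slim : Subgraph → Set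
  Slim H = Connected (InComplement H)

  SlimSubgraph : Set
  SlimSubgraph = Σ Subgraph Slim

  record ActGen : Set where
    field
      T   : SpanningTree
      S   : Subgraph
      isS : IsComplementOfTact T S

  module _ {c ℓ} (K : Field c ℓ) where
    open Poly K n

    Z : Subgraph → Pol
    Z H = foldr _*P_ 1P
            (concatMap (λ i → map (λ j →
               if isEdge? i j ∧ H i j then varDiff i j else 1P) (allFin n)) (allFin n))

    InSG : Pol → Set (c ⊔ ℓ)
    InSG = InSpan SlimSubgraph (λ h → Z (proj₁ h))

    InActSpan : Pol → Set (c ⊔ ℓ)
    InActSpan = InSpan ActGen (λ g → Z (ActGen.S g))

{-# OPTIONS --safe #-}
module Submission where

-- Z_{G∖T_act} lies in S_G because the complement T_act of G∖T_act contains the spanning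
-- tree T. Conversely, for slim H let T be the lexicographically maximal spanning tree of G∖H.
-- If no edge of H is externally active for T, then H = G∖T_act. Otherwise pick an active edge
-- ij of H: z_i - z_j telescopes into the z_p - z_q along the tree path from i to j, which
-- writes Z_H as a combination of the Z_{H - ij + pq}. Each H - ij + pq is slim, since pq is
-- bypassed by the rest of the cycle formed by ij and the path, and it is heavier for the
-- weight Σ_{e ∈ H} rank e, since pq lies lexicographically above ij. Induct on the weight.

open import Defs
open import Algebra.Bundles using (CommutativeMonoid; CommutativeRing)
import Algebra.Properties.CommutativeSemigroup as CommutativeSemigroupProperties
import Algebra.Properties.Ring as RingProperties
open import Algebra.Structures.Biased using (IsCommutativeMonoidˡ)
open import Data.Bool as Bool using (Bool; true; false; _∧_; if_then_else_)
import Data.Bool.Properties as BoolP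
open import Data.Fin as Fin using (Fin; _<_; toℕ)
import Data.Fin.Induction as FinInd
import Data.Fin.Properties as FinP
open import Data.List using (List; []; _∷_; _++_; map; foldr; concatMap; allFin; cartesianProduct; length; lookup)
import Data.List.Properties as ListP
open import Data.List.Membership.Propositional using (_∈_; _∉_)
open import Data.List.Membership.Propositional.Properties using (∈-cartesianProduct⁺; ∈-allFin; ∈-lookup)
import Data.List.Membership.DecPropositional as DecMembership
open import Data.List.Relation.Unary.All as All using (All; []; _∷_)
open import Data.List.Relation.Unary.All.Properties using (¬Any⇒All¬; All¬⇒¬Any)
open import Data.List.Relation.Unary.Any using (here; there)
open import Data.List.Relation.Unary.AllPairs using ([]; _∷_)
open import Data.List.Relation.Unary.Linked as Linked using (Linked; []; [-]; _∷_)
open import Data.List.Relation.Unary.Unique.Propositional using (Unique)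
open import Data.List.Relation.Unary.Unique.Propositional.Properties using (cartesianProduct⁺; allFin⁺)
import Data.List.Relation.Unary.Unique.DecPropositional as DecUnique
open import Data.Nat as ℕ using (ℕ; zero; suc; z≤n; s≤s; _∸_)
import Data.Nat.Induction as ℕInd
import Data.Nat.Properties as ℕP
open import Data.Product using (∃; ∃₂; _×_; _,_; proj₁; proj₂; swap; uncurry)
import Data.Product.Properties as ProductP
open import Data.Product.Relation.Binary.Lex.Strict
  using (×-Lex; ×-transitive; ×-irreflexive; ×-asymmetric; ×-compare; ×-wellFounded; ×-decidable)
open import Data.Product.Relation.Binary.Pointwise.NonDependent using (Pointwise)
open import Data.Sum as Sum using (_⊎_; inj₁; inj₂)
open import Data.Unit using (⊤; tt)
open import Data.Vec using (Vec; []; _∷_; zipWith; replicate)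
import Data.Vec.Properties as VecP
open import Data.Vec.Relation.Binary.Pointwise.Inductive
  using (Pointwise-≡⇒≡; zipWith-comm; zipWith-assoc; zipWith-identityˡ)
open import Function using (_∘_; flip)
open import Induction.WellFounded using (WellFounded; Acc; acc; module Subrelation)
open import Level using (0ℓ; _⊔_)
open import Relation.Binary
  using (Rel; Reflexive; Transitive; Asymmetric; Trichotomous; Decidable; DecidableEquality; tri<; tri≈; tri>)
open import Relation.Binary.Construct.Closure.ReflexiveTransitive as Star using (Star)
import Relation.Binary.PropositionalEquality as ≡
open ≡ using (_≡_; _≢_)
import Relation.Binary.Reasoning.Setoid as SetoidReasoning
open import Relation.Nullary using (¬_; Dec; yes; no; does)
open import Relation.Nullary.Decidable using (map′; _×-dec_; _⊎-dec_; ¬?; decidable-stable; dec-true; dec-false)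
open import Relation.Nullary.Negation using (contradiction)
import Relation.Unary as U

does≡true⇒ : ∀ {a} {A : Set a} (d : Dec A) → does d ≡ true → A
does≡true⇒ (yes a) _ = a

does≡false⇒ : ∀ {a} {A : Set a} (d : Dec A) → does d ≡ false → ¬ A
does≡false⇒ (no ¬a) _ = ¬a

infix 4 _≟²_
_≟²_ : ∀ {n} → DecidableEquality (Fin n × Fin n)
_≟²_ = ProductP.≡-dec FinP._≟_ FinP._≟_

infixl 6 _[_,_]≔_
_[_,_]≔_ : ∀ {a} {A : Set a} {n} → (Fin n → Fin n → A) → Fin n → Fin n → A → Fin n → Fin n → A
(f [ a , b ]≔ v) x y = if does ((x , y) ≟² (a , b)) then v else f x y

module _ {a} {A : Set a} {n} (f : Fin n → Fin n → A) where

  []≔-updated : ∀ {a b v} → (f [ a , b ]≔ v) a b ≡ v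
  []≔-updated {a} {b} {v} =
    ≡.cong (if_then v else f a b) (dec-true ((a , b) ≟² (a , b)) ≡.refl)

  []≔-other : ∀ {a b v x y} → (x , y) ≢ (a , b) → (f [ a , b ]≔ v) x y ≡ f x y
  []≔-other {a} {b} {v} {x} {y} xy≢ab =
    ≡.cong (if_then v else f x y) (dec-false ((x , y) ≟² (a , b)) xy≢ab)

  []≔-preserves : ∀ {p} (P : A → Set p) {a b v x y} → P v → P (f x y) → P ((f [ a , b ]≔ v) x y)
  []≔-preserves P {a} {b} {x = x} {y} pv pf with does ((x , y) ≟² (a , b))
  ... | true  = pv
  ... | false = pf

  []≔-restore : ∀ {a b v w x y} → f a b ≡ v → ((f [ a , b ]≔ w) [ a , b ]≔ v) x y ≡ f x y
  []≔-restore {a} {b} {x = x} {y} fab≡v with (x , y) ≟² (a , b)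
  ... | yes ≡.refl = ≡.sym fab≡v
  ... | no  _      = ≡.refl

module CommutativeMonoidProduct {c ℓ} (M : CommutativeMonoid c ℓ) where
  open CommutativeMonoid M
  open SetoidReasoning setoid
  open CommutativeSemigroupProperties commutativeSemigroup using (x∙yz≈y∙xz)

  product : List Carrier → Carrier
  product = foldr _∙_ ε

  product-extract : ∀ {a} {A : Set a} (f g : A → Carrier) {x xs} → Unique xs → x ∈ xs →
                    (∀ y → y ≢ x → f y ≡ g y) → g x ≈ ε →
                    product (map f xs) ≈ f x ∙ product (map g xs)
  product-extract f g {x} {_ ∷ ys} (x∉ys ∷ _) (here ≡.refl) f≡g gx≈ε = ∙-congˡ (begin
    product (map f ys)     ≡⟨ ≡.cong product (ListP.map-cong-local
                                (All.map (λ x≢y → f≡g _ (≡.≢-sym x≢y)) x∉ys)) ⟩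
    product (map g ys)     ≈⟨ identityˡ _ ⟨
    ε ∙ product (map g ys) ≈⟨ ∙-congʳ gx≈ε ⟨
    g x ∙ product (map g ys) ∎)
  product-extract f g {x} {y ∷ ys} (y∉ys ∷ unique) (there x∈ys) f≡g gx≈ε = begin
    f y ∙ product (map f ys)         ≈⟨ ∙-congˡ (product-extract f g unique x∈ys f≡g gx≈ε) ⟩
    f y ∙ (f x ∙ product (map g ys)) ≈⟨ x∙yz≈y∙xz _ _ _ ⟩
    f x ∙ (f y ∙ product (map g ys)) ≡⟨ ≡.cong (λ z → f x ∙ (z ∙ product (map g ys))) (f≡g y y≢x) ⟩
    f x ∙ product (map g (y ∷ ys))   ∎
    where y≢x = All.lookup y∉ys x∈ys

  ∏ : ∀ {n} → (Fin n → Fin n → Carrier) → Carrier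
  ∏ {n} f = product (concatMap (λ i → map (f i) (allFin n)) (allFin n))

  ∏-grid : ∀ {n} (f : Fin n → Fin n → Carrier) →
           ∏ f ≡ product (map (uncurry f) (cartesianProduct (allFin n) (allFin n)))
  ∏-grid {n} f = ≡.cong product (grid (allFin n) (allFin n))
    where
    grid : ∀ xs ys → concatMap (λ i → map (f i) ys) xs ≡ map (uncurry f) (cartesianProduct xs ys)
    grid []       ys = ≡.refl
    grid (x ∷ xs) ys = ≡.trans (≡.cong₂ _++_ (ListP.map-∘ ys) (grid xs ys))
                         (≡.sym (ListP.map-++ (uncurry f) (map (x ,_) ys) _))

  ∏-cong : ∀ {n} {f g : Fin n → Fin n → Carrier} → (∀ x y → f x y ≡ g x y) → ∏ f ≡ ∏ g
  ∏-cong {n} {f} {g} f≡g = ≡.trans (∏-grid f) (≡.trans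
    (≡.cong product (ListP.map-cong (λ (x , y) → f≡g x y) (cartesianProduct (allFin n) (allFin n))))
    (≡.sym (∏-grid g)))

  ∏-extract : ∀ {n} (f g : Fin n → Fin n → Carrier) {a b} →
              (∀ x y → (x , y) ≢ (a , b) → f x y ≡ g x y) → g a b ≈ ε → ∏ f ≈ f a b ∙ ∏ g
  ∏-extract {n} f g {a} {b} f≡g gab≈ε = begin
    ∏ f                                      ≡⟨ ∏-grid f ⟩
    product (map (uncurry f) pairs)          ≈⟨ product-extract (uncurry f) (uncurry g)
                                                  (cartesianProduct⁺ (allFin⁺ n) (allFin⁺ n))
                                                  (∈-cartesianProduct⁺ (∈-allFin a) (∈-allFin b))
                                                  (λ (x , y) → f≡g x y) gab≈ε ⟩
    f a b ∙ product (map (uncurry g) pairs)  ≡⟨ ≡.cong (f a b ∙_) (∏-grid g) ⟨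
    f a b ∙ ∏ g                              ∎
    where pairs = cartesianProduct (allFin n) (allFin n)

  ∏[_]_ : ∀ {n} → (Fin n → Fin n → Bool) → (Fin n → Fin n → Carrier) → Carrier
  ∏[ E ] w = ∏ (λ x y → if E x y then w x y else ε)

  ∏[]-cong : ∀ {n} {E E′ : Fin n → Fin n → Bool} w →
             (∀ x y → E x y ≡ E′ x y) → ∏[ E ] w ≡ ∏[ E′ ] w
  ∏[]-cong w E≡E′ = ∏-cong (λ x y → ≡.cong (if_then w x y else ε) (E≡E′ x y))

  ∏[]-extract : ∀ {n} {E : Fin n → Fin n → Bool} w {a b} → E a b ≡ true →
                ∏[ E ] w ≈ w a b ∙ ∏[ E [ a , b ]≔ false ] w
  ∏[]-extract {E = E} w {a} {b} Eab = begin
    ∏[ E ] w                                     ≈⟨ ∏-extract (term E) (term E′) off-ab at-ab ⟩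
    term E a b ∙ ∏[ E′ ] w                       ≡⟨ ≡.cong (λ e → (if e then w a b else ε) ∙ ∏[ E′ ] w) Eab ⟩
    w a b ∙ ∏[ E′ ] w                            ∎
    where
    E′ = E [ a , b ]≔ false
    term : (Fin _ → Fin _ → Bool) → Fin _ → Fin _ → Carrier
    term F x y = if F x y then w x y else ε
    off-ab : ∀ x y → (x , y) ≢ (a , b) → term E x y ≡ term E′ x y
    off-ab x y xy≢ab = ≡.cong (if_then w x y else ε) (≡.sym ([]≔-other E xy≢ab))
    at-ab : term E′ a b ≈ ε
    at-ab = reflexive (≡.cong (if_then w a b else ε) ([]≔-updated E))

module FiniteSums {c ℓ} (R : CommutativeRing c ℓ) where
  open CommutativeRing R
  open CommutativeSemigroupProperties +-commutativeSemigroup using (interchange)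

  infix 8 [_]·_
  [_]·_ : ∀ {a} {A : Set a} → Dec A → Carrier → Carrier
  [ d ]· v = if does d then v else 0#

  module _ {a b} {A : Set a} {B : Set b} where

    [·]-cong : (dA : Dec A) (dB : Dec B) → (A → B) → (B → A) → ∀ {v w} → v ≈ w → [ dA ]· v ≈ [ dB ]· w
    [·]-cong (yes _) (yes _) _   _   v≈w = v≈w
    [·]-cong (yes a) (no ¬b) a→b _   _   = contradiction (a→b a) ¬b
    [·]-cong (no ¬a) (yes b) _   b→a _   = contradiction (b→a b) ¬a
    [·]-cong (no _)  (no _)  _   _   _   = refl

  [·]-congʳ : ∀ {a} {A : Set a} (d : Dec A) {v w} → v ≈ w → [ d ]· v ≈ [ d ]· w
  [·]-congʳ d = [·]-cong d d (λ x → x) (λ x → x)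

  [·]-no : ∀ {a} {A : Set a} (d : Dec A) {v} → ¬ A → [ d ]· v ≈ 0#
  [·]-no (yes a) ¬a = contradiction a ¬a
  [·]-no (no _)  _  = refl

  *-[·] : ∀ {a} {A : Set a} (d : Dec A) k v → k * [ d ]· v ≈ [ d ]· (k * v)
  *-[·] (yes _) k v = refl
  *-[·] (no _)  k v = zeroʳ k

  ∑ : ∀ {a} {A : Set a} → (A → Carrier) → List A → Carrier
  ∑ f []       = 0#
  ∑ f (x ∷ xs) = f x + ∑ f xs

  module _ {a} {A : Set a} where

    ∑-cong : ∀ {f g : A → Carrier} → (∀ x → f x ≈ g x) → ∀ xs → ∑ f xs ≈ ∑ g xs
    ∑-cong f≈g []       = refl
    ∑-cong f≈g (x ∷ xs) = +-cong (f≈g x) (∑-cong f≈g xs)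

    ∑-++ : ∀ (f : A → Carrier) xs ys → ∑ f (xs ++ ys) ≈ ∑ f xs + ∑ f ys
    ∑-++ f []       ys = sym (+-identityˡ _)
    ∑-++ f (x ∷ xs) ys = trans (+-congˡ (∑-++ f xs ys)) (sym (+-assoc _ _ _))

    ∑-zero : ∀ xs → ∑ (λ (_ : A) → 0#) xs ≈ 0#
    ∑-zero []       = refl
    ∑-zero (x ∷ xs) = trans (+-identityˡ _) (∑-zero xs)

    ∑-+ : ∀ (f g : A → Carrier) xs → ∑ (λ x → f x + g x) xs ≈ ∑ f xs + ∑ g xs
    ∑-+ f g []       = sym (+-identityˡ _)
    ∑-+ f g (x ∷ xs) = trans (+-congˡ (∑-+ f g xs)) (interchange _ _ _ _)

    *-distribˡ-∑ : ∀ k (f : A → Carrier) xs → k * ∑ f xs ≈ ∑ (λ x → k * f x) xs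
    *-distribˡ-∑ k f []       = zeroʳ k
    *-distribˡ-∑ k f (x ∷ xs) = trans (distribˡ _ _ _) (+-congˡ (*-distribˡ-∑ k f xs))

    ∑-map : ∀ {b} {B : Set b} (f : A → Carrier) (g : B → A) xs → ∑ f (map g xs) ≡ ∑ (f ∘ g) xs
    ∑-map f g []       = ≡.refl
    ∑-map f g (x ∷ xs) = ≡.cong (f (g x) +_) (∑-map f g xs)

    ∑-concatMap : ∀ {b} {B : Set b} (f : A → Carrier) (g : B → List A) xs →
                  ∑ f (concatMap g xs) ≈ ∑ (λ x → ∑ f (g x)) xs
    ∑-concatMap f g []       = refl
    ∑-concatMap f g (x ∷ xs) = trans (∑-++ f (g x) (concatMap g xs)) (+-congˡ (∑-concatMap f g xs))

  ∑-comm : ∀ {a b} {A : Set a} {B : Set b} (F : A → B → Carrier) xs ys →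
           ∑ (λ x → ∑ (F x) ys) xs ≈ ∑ (λ y → ∑ (λ x → F x y) xs) ys
  ∑-comm F []       ys = sym (∑-zero ys)
  ∑-comm F (x ∷ xs) ys = trans (+-congˡ (∑-comm F xs ys)) (sym (∑-+ (F x) _ ys))

module PolynomialArithmetic {c ℓ} (K : Field c ℓ) (n : ℕ) where
  open Field K
  open Poly K n
  open SetoidReasoning setoid
  open FiniteSums commutativeRing
  open RingProperties ring using (-1*x≈-x; -‿anti-homo-+; -‿involutive)

  infixl 6 _+ᴹ_ _∸ᴹ_
  _+ᴹ_ _∸ᴹ_ : Monomial → Monomial → Monomial
  _+ᴹ_ = zipWith ℕ._+_
  _∸ᴹ_ = zipWith ℕ._∸_

  +ᴹ-comm : ∀ α β → α +ᴹ β ≡ β +ᴹ α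
  +ᴹ-comm α β = Pointwise-≡⇒≡ (zipWith-comm ℕP.+-comm α β)

  +ᴹ-assoc : ∀ α β γ → (α +ᴹ β) +ᴹ γ ≡ α +ᴹ (β +ᴹ γ)
  +ᴹ-assoc α β γ = Pointwise-≡⇒≡ (zipWith-assoc ℕP.+-assoc α β γ)

  +ᴹ-identityˡ : ∀ α → replicate n 0 +ᴹ α ≡ α
  +ᴹ-identityˡ α = Pointwise-≡⇒≡ (zipWith-identityˡ ℕP.+-identityˡ α)

  +ᴹ-∸ᴹ : ∀ {k} (β γ : Vec ℕ k) → zipWith ℕ._∸_ (zipWith ℕ._+_ β γ) β ≡ γ
  +ᴹ-∸ᴹ []      []      = ≡.refl
  +ᴹ-∸ᴹ (b ∷ β) (g ∷ γ) = ≡.cong₂ _∷_ (ℕP.m+n∸m≡n b g) (+ᴹ-∸ᴹ β γ)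

  infix 4 _≟ᴹ_
  _≟ᴹ_ : DecidableEquality Monomial
  _≟ᴹ_ = VecP.≡-dec ℕP._≟_

  coeffAt : Monomial → Carrier × Monomial → Carrier
  coeffAt α (a , β) = [ β ≟ᴹ α ]· a

  coeff-∑ : ∀ p α → coeff p α ≈ ∑ (coeffAt α) p
  coeff-∑ []            α = refl
  coeff-∑ ((a , β) ∷ p) α with β ≟ᴹ α
  ... | yes _ = +-congˡ (coeff-∑ p α)
  ... | no _  = trans (coeff-∑ p α) (sym (+-identityˡ _))

  [≟ᴹ]-cong : ∀ {β γ} α {v w} → β ≡ γ → v ≈ w → [ β ≟ᴹ α ]· v ≈ [ γ ≟ᴹ α ]· w
  [≟ᴹ]-cong {β} α ≡.refl = [·]-congʳ (β ≟ᴹ α)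

  infixl 7 _·ᵗ_
  _·ᵗ_ : Carrier × Monomial → Carrier × Monomial → Carrier × Monomial
  (a , β) ·ᵗ (b , γ) = a * b , β +ᴹ γ

  ∑-*P : ∀ (f : Carrier × Monomial → Carrier) p q →
         ∑ f (p *P q) ≈ ∑ (λ x → ∑ (λ y → f (x ·ᵗ y)) q) p
  ∑-*P f p q = trans (∑-concatMap f _ p) (∑-cong (λ x → reflexive (∑-map f _ q)) p)

  coeff-+P : ∀ p q α → coeff (p +P q) α ≈ coeff p α + coeff q α
  coeff-+P p q α = begin
    coeff (p ++ q) α                  ≈⟨ coeff-∑ (p ++ q) α ⟩
    ∑ (coeffAt α) (p ++ q)            ≈⟨ ∑-++ (coeffAt α) p q ⟩
    ∑ (coeffAt α) p + ∑ (coeffAt α) q ≈⟨ +-cong (coeff-∑ p α) (coeff-∑ q α) ⟨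
    coeff p α + coeff q α             ∎

  coeff-·P : ∀ k p α → coeff (k ·P p) α ≈ k * coeff p α
  coeff-·P k p α = begin
    coeff (k ·P p) α                      ≈⟨ coeff-∑ (k ·P p) α ⟩
    ∑ (coeffAt α) (k ·P p)                ≡⟨ ∑-map (coeffAt α) _ p ⟩
    ∑ (λ (a , β) → [ β ≟ᴹ α ]· (k * a)) p ≈⟨ ∑-cong (λ (a , β) → *-[·] (β ≟ᴹ α) k a) p ⟨
    ∑ (λ x → k * coeffAt α x) p           ≈⟨ *-distribˡ-∑ k (coeffAt α) p ⟨
    k * ∑ (coeffAt α) p                   ≈⟨ *-congˡ (coeff-∑ p α) ⟨
    k * coeff p α                         ∎

  coeff-*P : ∀ p q α → coeff (p *P q) α ≈ ∑ (λ x → ∑ (λ y → coeffAt α (x ·ᵗ y)) q) p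
  coeff-*P p q α = trans (coeff-∑ (p *P q) α) (∑-*P (coeffAt α) p q)

  ≈P-refl : ∀ {p} → p ≈P p
  ≈P-refl α = refl

  ≈P-sym : ∀ {p q} → p ≈P q → q ≈P p
  ≈P-sym p≈q α = sym (p≈q α)

  ≈P-trans : ∀ {p q r} → p ≈P q → q ≈P r → p ≈P r
  ≈P-trans p≈q q≈r α = trans (p≈q α) (q≈r α)

  ≡⇒≈P : ∀ {p q} → p ≡ q → p ≈P q
  ≡⇒≈P ≡.refl α = refl

  +P-cong : ∀ {p p′ q q′} → p ≈P p′ → q ≈P q′ → p +P q ≈P p′ +P q′
  +P-cong {p} {p′} {q} {q′} p≈p′ q≈q′ α =
    trans (coeff-+P p q α) (trans (+-cong (p≈p′ α) (q≈q′ α)) (sym (coeff-+P p′ q′ α)))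

  ·P-cong : ∀ k {p q} → p ≈P q → k ·P p ≈P k ·P q
  ·P-cong k {p} {q} p≈q α = trans (coeff-·P k p α) (trans (*-congˡ (p≈q α)) (sym (coeff-·P k q α)))

  *P-comm : ∀ p q → p *P q ≈P q *P p
  *P-comm p q α = begin
    coeff (p *P q) α
      ≈⟨ coeff-*P p q α ⟩
    ∑ (λ x → ∑ (λ y → coeffAt α (x ·ᵗ y)) q) p
      ≈⟨ ∑-comm (λ x y → coeffAt α (x ·ᵗ y)) p q ⟩
    ∑ (λ y → ∑ (λ x → coeffAt α (x ·ᵗ y)) p) q
      ≈⟨ ∑-cong (λ (b , γ) → ∑-cong (λ (a , β) → [≟ᴹ]-cong α (+ᴹ-comm β γ) (*-comm a b)) p) q ⟩
    ∑ (λ y → ∑ (λ x → coeffAt α (y ·ᵗ x)) p) q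
      ≈⟨ coeff-*P q p α ⟨
    coeff (q *P p) α
      ∎

  -- The only monomial γ with β +ᴹ γ ≡ α is α ∸ᴹ β.
  ∑-coeffAt-·ᵗ : ∀ α a β q → let δ = α ∸ᴹ β in
    ∑ (λ y → coeffAt α ((a , β) ·ᵗ y)) q ≈ [ β +ᴹ δ ≟ᴹ α ]· (a * coeff q δ)
  ∑-coeffAt-·ᵗ α a β q with β +ᴹ (α ∸ᴹ β) ≟ᴹ α
  ... | yes β+δ≡α = begin
    ∑ (λ y → coeffAt α ((a , β) ·ᵗ y)) q ≈⟨ ∑-cong (λ (b , γ) → trans
                                               ([·]-cong (β +ᴹ γ ≟ᴹ α) (γ ≟ᴹ δ) (≡.sym ∘ ∸ᴹ-inverse)
                                                         (λ { ≡.refl → β+δ≡α }) refl)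
                                               (sym (*-[·] (γ ≟ᴹ δ) a b))) q ⟩
    ∑ (λ y → a * coeffAt δ y) q          ≈⟨ *-distribˡ-∑ a (coeffAt δ) q ⟨
    a * ∑ (coeffAt δ) q                  ≈⟨ *-congˡ (coeff-∑ q δ) ⟨
    a * coeff q δ                        ∎
    where
    δ = α ∸ᴹ β
    ∸ᴹ-inverse : ∀ {γ} → β +ᴹ γ ≡ α → δ ≡ γ
    ∸ᴹ-inverse {γ} ≡.refl = +ᴹ-∸ᴹ β γ
  ... | no β+δ≢α =
    trans (∑-cong (λ (b , γ) → [·]-no (β +ᴹ γ ≟ᴹ α) (β+δ≢α ∘ β+γ≡α⇒β+δ≡α)) q) (∑-zero q)
    where
    β+γ≡α⇒β+δ≡α : ∀ {γ} → β +ᴹ γ ≡ α → β +ᴹ (α ∸ᴹ β) ≡ α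
    β+γ≡α⇒β+δ≡α {γ} ≡.refl = ≡.cong (β +ᴹ_) (+ᴹ-∸ᴹ β γ)

  *P-congˡ : ∀ p {q q′} → q ≈P q′ → p *P q ≈P p *P q′
  *P-congˡ p {q} {q′} q≈q′ α = begin
    coeff (p *P q) α                            ≈⟨ coeff-*P p q α ⟩
    ∑ (λ x → ∑ (λ y → coeffAt α (x ·ᵗ y)) q) p  ≈⟨ ∑-cong (λ (a , β) → begin
      ∑ (λ y → coeffAt α ((a , β) ·ᵗ y)) q
        ≈⟨ ∑-coeffAt-·ᵗ α a β q ⟩
      [ β +ᴹ (α ∸ᴹ β) ≟ᴹ α ]· (a * coeff q (α ∸ᴹ β))
        ≈⟨ [·]-congʳ (β +ᴹ (α ∸ᴹ β) ≟ᴹ α) (*-congˡ (q≈q′ _)) ⟩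
      [ β +ᴹ (α ∸ᴹ β) ≟ᴹ α ]· (a * coeff q′ (α ∸ᴹ β))
        ≈⟨ ∑-coeffAt-·ᵗ α a β q′ ⟨
      ∑ (λ y → coeffAt α ((a , β) ·ᵗ y)) q′
        ∎) p ⟩
    ∑ (λ x → ∑ (λ y → coeffAt α (x ·ᵗ y)) q′) p ≈⟨ coeff-*P p q′ α ⟨
    coeff (p *P q′) α                           ∎

  *P-congʳ : ∀ {p p′} q → p ≈P p′ → p *P q ≈P p′ *P q
  *P-congʳ {p} {p′} q p≈p′ = ≈P-trans {p *P q} {q *P p} {p′ *P q} (*P-comm p q)
                                (≈P-trans {q *P p} {q *P p′} {p′ *P q} (*P-congˡ q p≈p′) (*P-comm q p′))

  *P-assoc : ∀ p q r → (p *P q) *P r ≈P p *P (q *P r)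
  *P-assoc p q r α = begin
    coeff ((p *P q) *P r) α
      ≈⟨ coeff-*P (p *P q) r α ⟩
    ∑ (λ x → ∑ (λ z → coeffAt α (x ·ᵗ z)) r) (p *P q)
      ≈⟨ ∑-*P _ p q ⟩
    ∑ (λ x → ∑ (λ y → ∑ (λ z → coeffAt α ((x ·ᵗ y) ·ᵗ z)) r) q) p
      ≈⟨ ∑-cong (λ (a , β) → ∑-cong (λ (b , γ) → ∑-cong (λ (c , δ) →
           [≟ᴹ]-cong α (+ᴹ-assoc β γ δ) (*-assoc a b c)) r) q) p ⟩
    ∑ (λ x → ∑ (λ y → ∑ (λ z → coeffAt α (x ·ᵗ (y ·ᵗ z))) r) q) p
      ≈⟨ ∑-cong (λ x → ∑-*P (λ y → coeffAt α (x ·ᵗ y)) q r) p ⟨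
    ∑ (λ x → ∑ (λ y → coeffAt α (x ·ᵗ y)) (q *P r)) p
      ≈⟨ coeff-*P p (q *P r) α ⟨
    coeff (p *P (q *P r)) α
      ∎

  *P-identityˡ : ∀ p → 1P *P p ≈P p
  *P-identityˡ p α = begin
    coeff (1P *P p) α                                      ≈⟨ coeff-*P 1P p α ⟩
    ∑ (λ y → coeffAt α ((1# , replicate n 0) ·ᵗ y)) p + 0# ≈⟨ +-identityʳ _ ⟩
    ∑ (λ y → coeffAt α ((1# , replicate n 0) ·ᵗ y)) p      ≈⟨ ∑-cong (λ (b , γ) →
                                                                [≟ᴹ]-cong α (+ᴹ-identityˡ γ) (*-identityˡ b)) p ⟩
    ∑ (coeffAt α) p                                        ≈⟨ coeff-∑ p α ⟨
    coeff p α                                              ∎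

  ·P-*P : ∀ k p q → (k ·P p) *P q ≈P k ·P (p *P q)
  ·P-*P k p q α = begin
    coeff ((k ·P p) *P q) α                                    ≈⟨ coeff-*P (k ·P p) q α ⟩
    ∑ (λ x → ∑ (λ y → coeffAt α (x ·ᵗ y)) q) (k ·P p)          ≡⟨ ∑-map _ _ p ⟩
    ∑ (λ (a , β) → ∑ (λ y → coeffAt α ((k * a , β) ·ᵗ y)) q) p
      ≈⟨ ∑-cong (λ (a , β) → ∑-cong (λ (b , γ) → trans ([·]-congʳ (β +ᴹ γ ≟ᴹ α) (*-assoc k a b))
                                                      (sym (*-[·] (β +ᴹ γ ≟ᴹ α) k (a * b)))) q) p ⟩
    ∑ (λ x → ∑ (λ y → k * coeffAt α (x ·ᵗ y)) q) p             ≈⟨ ∑-cong (λ x → *-distribˡ-∑ k _ q) p ⟨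
    ∑ (λ x → k * ∑ (λ y → coeffAt α (x ·ᵗ y)) q) p             ≈⟨ *-distribˡ-∑ k _ p ⟨
    k * ∑ (λ x → ∑ (λ y → coeffAt α (x ·ᵗ y)) q) p             ≈⟨ *-congˡ (coeff-*P p q α) ⟨
    k * coeff (p *P q) α                                       ≈⟨ coeff-·P k (p *P q) α ⟨
    coeff (k ·P (p *P q)) α                                    ∎

  *P-distribʳ-+P : ∀ p p′ q → (p +P p′) *P q ≡ (p *P q) +P (p′ *P q)
  *P-distribʳ-+P p p′ q = ListP.concatMap-++ _ p p′

  *P-commutativeMonoid : CommutativeMonoid c ℓ
  *P-commutativeMonoid = record
    { Carrier = Pol
    ; _≈_ = _≈P_
    ; _∙_ = _*P_
    ; ε = 1P
    ; isCommutativeMonoid = IsCommutativeMonoidˡ.isCommutativeMonoid (record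
      { isSemigroup = record
        { isMagma = record
          { isEquivalence = record
            { refl  = λ {p} → ≈P-refl {p}
            ; sym   = λ {p} {q} → ≈P-sym {p} {q}
            ; trans = λ {p} {q} {r} → ≈P-trans {p} {q} {r}
            }
          ; ∙-cong = λ {p} {p′} {q} {q′} p≈p′ q≈q′ →
              ≈P-trans {p *P q} {p′ *P q} {p′ *P q′} (*P-congʳ {p} {p′} q p≈p′) (*P-congˡ p′ q≈q′)
          }
        ; assoc = *P-assoc
        }
      ; identityˡ = *P-identityˡ
      ; comm = *P-comm
      })
    }

  coeff-varDiff : ∀ i j α → coeff (varDiff i j) α ≈ coeff (var i) α + - coeff (var j) α
  coeff-varDiff i j α = begin
    coeff (varDiff i j) α                       ≈⟨ coeff-+P (var i) ((- 1#) ·P var j) α ⟩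
    coeff (var i) α + coeff ((- 1#) ·P var j) α ≈⟨ +-congˡ (coeff-·P (- 1#) (var j) α) ⟩
    coeff (var i) α + - 1# * coeff (var j) α    ≈⟨ +-congˡ (-1*x≈-x _) ⟩
    coeff (var i) α + - coeff (var j) α         ∎

  varDiff-self : ∀ i → varDiff i i ≈P 0P
  varDiff-self i α = trans (coeff-varDiff i i α) (-‿inverseʳ _)

  varDiff-trans : ∀ i j k → varDiff i j +P varDiff j k ≈P varDiff i k
  varDiff-trans i j k α = begin
    coeff (varDiff i j +P varDiff j k) α          ≈⟨ coeff-+P (varDiff i j) (varDiff j k) α ⟩
    coeff (varDiff i j) α + coeff (varDiff j k) α ≈⟨ +-cong (coeff-varDiff i j α) (coeff-varDiff j k α) ⟩
    (x + - y) + (y + - z)                         ≈⟨ +-assoc _ _ _ ⟩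
    x + (- y + (y + - z))                         ≈⟨ +-congˡ (+-assoc _ _ _) ⟨
    x + ((- y + y) + - z)                         ≈⟨ +-congˡ (+-congʳ (-‿inverseˡ y)) ⟩
    x + (0# + - z)                                ≈⟨ +-congˡ (+-identityˡ _) ⟩
    x + - z                                       ≈⟨ coeff-varDiff i k α ⟨
    coeff (varDiff i k) α                         ∎
    where x = coeff (var i) α; y = coeff (var j) α; z = coeff (var k) α

  varDiff-swap : ∀ i j → varDiff i j ≈P (- 1#) ·P varDiff j i
  varDiff-swap i j α = begin
    coeff (varDiff i j) α              ≈⟨ coeff-varDiff i j α ⟩
    x + - y                            ≈⟨ +-congʳ (-‿involutive x) ⟨
    - - x + - y                        ≈⟨ -‿anti-homo-+ y (- x) ⟨
    - (y + - x)                        ≈⟨ -1*x≈-x _ ⟨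
    - 1# * (y + - x)                   ≈⟨ *-congˡ (coeff-varDiff j i α) ⟨
    - 1# * coeff (varDiff j i) α       ≈⟨ coeff-·P (- 1#) (varDiff j i) α ⟨
    coeff ((- 1#) ·P varDiff j i) α    ∎
    where x = coeff (var i) α; y = coeff (var j) α

  varDiff-self-*P : ∀ i q → 0P ≈P varDiff i i *P q
  varDiff-self-*P i q = ≈P-sym {varDiff i i *P q} {0P *P q} (*P-congʳ {varDiff i i} {0P} q (varDiff-self i))

  varDiff-trans-*P : ∀ i j k q → (varDiff i j *P q) +P (varDiff j k *P q) ≈P varDiff i k *P q
  varDiff-trans-*P i j k q α = begin
    coeff ((varDiff i j *P q) +P (varDiff j k *P q)) α
      ≡⟨ ≡.cong (λ r → coeff r α) (*P-distribʳ-+P (varDiff i j) (varDiff j k) q) ⟨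
    coeff ((varDiff i j +P varDiff j k) *P q) α
      ≈⟨ *P-congʳ {varDiff i j +P varDiff j k} {varDiff i k} q (varDiff-trans i j k) α ⟩
    coeff (varDiff i k *P q) α
      ∎

  varDiff-swap-*P : ∀ i j q → (- 1#) ·P (varDiff j i *P q) ≈P varDiff i j *P q
  varDiff-swap-*P i j q α = begin
    coeff ((- 1#) ·P (varDiff j i *P q)) α ≈⟨ ·P-*P (- 1#) (varDiff j i) q α ⟨
    coeff (((- 1#) ·P varDiff j i) *P q) α ≈⟨ *P-congʳ {(- 1#) ·P varDiff j i} {varDiff i j} q
                                                (≈P-sym {varDiff i j} {(- 1#) ·P varDiff j i} (varDiff-swap i j)) α ⟩
    coeff (varDiff i j *P q) α             ∎

  module _ {i} {I : Set i} (f : I → Pol) where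

    InSpan-resp : ∀ {p q} → InSpan I f p → p ≈P q → InSpan I f q
    InSpan-resp (cs , Σcs≈p) p≈q = cs , λ α → trans (Σcs≈p α) (p≈q α)

    InSpan-zero : ∀ {p} → 0P ≈P p → InSpan I f p
    InSpan-zero 0≈p = [] , 0≈p

    InSpan-gen : ∀ x → InSpan I f (f x)
    InSpan-gen x = (1# , x) ∷ [] , λ α → begin
      coeff ((1# ·P f x) +P 0P) α ≈⟨ coeff-+P (1# ·P f x) 0P α ⟩
      coeff (1# ·P f x) α + 0#    ≈⟨ +-identityʳ _ ⟩
      coeff (1# ·P f x) α         ≈⟨ coeff-·P 1# (f x) α ⟩
      1# * coeff (f x) α          ≈⟨ *-identityˡ _ ⟩
      coeff (f x) α               ∎

    InSpan-+ : ∀ {p q} → InSpan I f p → InSpan I f q → InSpan I f (p +P q)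
    InSpan-+ {p} {q} (cs , Σcs≈p) (ds , Σds≈q) = cs ++ ds , λ α → begin
      coeff (linComb f (cs ++ ds)) α                 ≡⟨ ≡.cong (λ r → coeff r α) (linComb-++ cs ds) ⟩
      coeff (linComb f cs +P linComb f ds) α         ≈⟨ +P-cong {linComb f cs} {p} Σcs≈p Σds≈q α ⟩
      coeff (p +P q) α                               ∎
      where
      linComb-++ : ∀ cs ds → linComb f (cs ++ ds) ≡ linComb f cs +P linComb f ds
      linComb-++ []             ds = ≡.refl
      linComb-++ ((k , x) ∷ cs) ds =
        ≡.trans (≡.cong ((k ·P f x) ++_) (linComb-++ cs ds)) (≡.sym (ListP.++-assoc (k ·P f x) _ _))

    InSpan-· : ∀ k {p} → InSpan I f p → InSpan I f (k ·P p)
    InSpan-· k {p} (cs , Σcs≈p) =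
      scale cs , λ α → trans (linComb-scale cs α) (·P-cong k {linComb f cs} {p} Σcs≈p α)
      where
      scale : List (Carrier × I) → List (Carrier × I)
      scale = map (λ (a , x) → k * a , x)
      linComb-scale : ∀ cs → linComb f (scale cs) ≈P k ·P linComb f cs
      linComb-scale []             α = refl
      linComb-scale ((a , x) ∷ cs) α = begin
        coeff (((k * a) ·P f x) +P linComb f (scale cs)) α
          ≈⟨ coeff-+P ((k * a) ·P f x) (linComb f (scale cs)) α ⟩
        coeff ((k * a) ·P f x) α + coeff (linComb f (scale cs)) α
          ≈⟨ +-cong (coeff-·P (k * a) (f x) α) (linComb-scale cs α) ⟩
        (k * a) * coeff (f x) α + coeff (k ·P linComb f cs) α
          ≈⟨ +-cong (*-assoc _ _ _) (coeff-·P k (linComb f cs) α) ⟩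
        k * (a * coeff (f x) α) + k * coeff (linComb f cs) α
          ≈⟨ distribˡ _ _ _ ⟨
        k * (a * coeff (f x) α + coeff (linComb f cs) α)
          ≈⟨ *-congˡ (+-congʳ (coeff-·P a (f x) α)) ⟨
        k * (coeff (a ·P f x) α + coeff (linComb f cs) α)
          ≈⟨ *-congˡ (coeff-+P (a ·P f x) (linComb f cs) α) ⟨
        k * coeff ((a ·P f x) +P linComb f cs) α
          ≈⟨ coeff-·P k ((a ·P f x) +P linComb f cs) α ⟨
        coeff (k ·P ((a ·P f x) +P linComb f cs)) α
          ∎

module LexicographicEdgeOrder {n : ℕ} where

  infix 4 _<ₗₑₓ_
  _<ₗₑₓ_ : Rel (Fin n × Fin n) 0ℓ
  _<ₗₑₓ_ = ×-Lex _≡_ _<_ _<_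

  <ₗₑₓ-trans : Transitive _<ₗₑₓ_
  <ₗₑₓ-trans =
    ×-transitive {_<₁_ = _<_} {_<₂_ = _<_} ≡.isEquivalence FinP.<-resp₂-≡ FinP.<-trans FinP.<-trans

  <ₗₑₓ-irrefl : ∀ {e} → ¬ e <ₗₑₓ e
  <ₗₑₓ-irrefl = ×-irreflexive {_<₁_ = _<_} {_<₂_ = _<_} FinP.<-irrefl FinP.<-irrefl (≡.refl , ≡.refl)

  <ₗₑₓ-asym : Asymmetric _<ₗₑₓ_
  <ₗₑₓ-asym = ×-asymmetric {_<₁_ = _<_} {_<₂_ = _<_} ≡.sym FinP.<-resp₂-≡ FinP.<-asym FinP.<-asym

  <ₗₑₓ-cmp : Trichotomous (Pointwise _≡_ _≡_) _<ₗₑₓ_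
  <ₗₑₓ-cmp = ×-compare ≡.sym FinP.<-cmp FinP.<-cmp

  <ₗₑₓ-dec : Decidable _<ₗₑₓ_
  <ₗₑₓ-dec = ×-decidable FinP._≟_ Fin._<?_ Fin._<?_

  <ₗₑₓ-wellFounded : WellFounded _<ₗₑₓ_
  <ₗₑₓ-wellFounded = ×-wellFounded FinInd.<-wellFounded FinInd.<-wellFounded

  >ₗₑₓ-wellFounded : WellFounded (flip _<ₗₑₓ_)
  >ₗₑₓ-wellFounded = Subrelation.wellFounded flipped (×-wellFounded FinInd.>-wellFounded FinInd.>-wellFounded)
    where
    flipped : ∀ {e e′} → e′ <ₗₑₓ e → ×-Lex _≡_ (flip _<_) (flip _<_) e e′
    flipped (inj₁ i′<i)         = inj₁ i′<i
    flipped (inj₂ (i′≡i , j′<j)) = inj₂ (≡.sym i′≡i , j′<j)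

  rank : Fin n × Fin n → ℕ
  rank (i , j) = toℕ i ℕ.* n ℕ.+ toℕ j

  rank-mono : ∀ {e e′} → e <ₗₑₓ e′ → rank e ℕ.< rank e′
  rank-mono {i , j} {k , l} (inj₁ i<k) = begin-strict
    toℕ i ℕ.* n ℕ.+ toℕ j  <⟨ ℕP.+-monoʳ-< (toℕ i ℕ.* n) (FinP.toℕ<n j) ⟩
    toℕ i ℕ.* n ℕ.+ n      ≡⟨ ℕP.+-comm (toℕ i ℕ.* n) n ⟩
    suc (toℕ i) ℕ.* n      ≤⟨ ℕP.*-monoˡ-≤ n i<k ⟩
    toℕ k ℕ.* n            ≤⟨ ℕP.m≤m+n (toℕ k ℕ.* n) (toℕ l) ⟩
    toℕ k ℕ.* n ℕ.+ toℕ l  ∎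
    where open ℕP.≤-Reasoning
  rank-mono {i , j} (inj₂ (≡.refl , j<l)) = ℕP.+-monoʳ-< (toℕ i ℕ.* n) j<l

  Undirected : (Fin n × Fin n → Set) → Rel (Fin n) 0ℓ
  Undirected Q x y = (x < y × Q (x , y)) ⊎ (y < x × Q (y , x))

  Undirected-sym : ∀ {Q x y} → Undirected Q x y → Undirected Q y x
  Undirected-sym (inj₁ q) = inj₂ q
  Undirected-sym (inj₂ q) = inj₁ q

  Undirected-ordered : ∀ {Q x y} → x < y → Undirected Q x y → Q (x , y)
  Undirected-ordered _   (inj₁ (_ , q))   = q
  Undirected-ordered x<y (inj₂ (y<x , _)) = contradiction y<x (FinP.<-asym x<y)

  undirected? : ∀ {Q} → U.Decidable Q → Decidable (Undirected Q)
  undirected? Q? x y = (x Fin.<? y ×-dec Q? (x , y)) ⊎-dec (y Fin.<? x ×-dec Q? (y , x))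

module Paths {n m : ℕ} (t : Fin n → Fin m) where
  open import Relation.Binary.Construct.Closure.ReflexiveTransitive using (ε; _◅_; _◅◅_)
  open Tiered t
  open DecMembership (FinP._≟_ {n}) using (_∈?_)
  open DecUnique (FinP._≟_ {n}) using (unique?)

  endsAt-∈ : ∀ u xs → endsAt u xs ∈ u ∷ xs
  endsAt-∈ u []       = here ≡.refl
  endsAt-∈ u (x ∷ xs) = there (endsAt-∈ x xs)

  module _ {R : Rel (Fin n) 0ℓ} where

    linked⇒star : ∀ u xs → Linked R (u ∷ xs) → Star R u (endsAt u xs)
    linked⇒star u []       _        = ε
    linked⇒star u (x ∷ xs) (r ∷ rs) = r ◅ linked⇒star x xs rs

    walk⇒star : ∀ {u v} → Walk R u v → Star R u v
    walk⇒star {u} (xs , rs , ≡.refl) = linked⇒star u xs rs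

    star⇒walk : ∀ {u v} → Star R u v → Walk R u v
    star⇒walk ε                   = [] , [-] , ≡.refl
    star⇒walk (_◅_ {j = x} r w) with star⇒walk w
    ... | xs , rs , ends = x ∷ xs , r ∷ rs , ends

    simplePath⇒star : ∀ {u v} → SimplePath R u v → Star R u v
    simplePath⇒star (xs , rs , _ , ends) = walk⇒star (xs , rs , ends)

    simplePath-suffix : ∀ {x w} ys → w ∈ x ∷ ys → Linked R (x ∷ ys) → Unique (x ∷ ys) →
                        SimplePath R w (endsAt x ys)
    simplePath-suffix ys       (here ≡.refl) rs       uniq       = ys , rs , uniq , ≡.refl
    simplePath-suffix (y ∷ ys) (there w∈ys)  (_ ∷ rs) (_ ∷ uniq) = simplePath-suffix ys w∈ys rs uniq

    -- Loop erasure: whenever the walk revisits a vertex, cut off the loop.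
    star⇒simplePath : ∀ {u v} → Star R u v → SimplePath R u v
    star⇒simplePath ε = [] , [-] , [] ∷ [] , ≡.refl
    star⇒simplePath {u} (_◅_ {j = x} r w) with star⇒simplePath w
    ... | ys , rs , uniq , ends with u ∈? x ∷ ys
    ...   | yes u∈ = ≡.subst (SimplePath R u) ends (simplePath-suffix ys u∈ rs uniq)
    ...   | no  u∉ = x ∷ ys , r ∷ rs , ¬Any⇒All¬ _ u∉ ∷ uniq , ends

  boundedSearch : ∀ k (P : List (Fin n) → Set) → U.Decidable P → Dec (∃ λ xs → length xs ℕ.≤ k × P xs)
  boundedSearch k P P? with P? []
  ... | yes p = yes ([] , z≤n , p)
  boundedSearch zero    P P? | no ¬p = no λ { ([] , _ , p) → ¬p p }
  boundedSearch (suc k) P P? | no ¬p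
    with FinP.any? (λ x → boundedSearch k (P ∘ (x ∷_)) (P? ∘ (x ∷_)))
  ... | yes (x , xs , ≤k , p) = yes (x ∷ xs , s≤s ≤k , p)
  ... | no ¬q = no λ { ([] , _ , p) → ¬p p ; (x ∷ xs , s≤s ≤k , p) → ¬q (x , xs , ≤k , p) }

  unique⇒length≤ : ∀ {xs : List (Fin n)} → Unique xs → length xs ℕ.≤ n
  unique⇒length≤ {xs} uniq with length xs ℕ.≤? n
  ... | yes ≤n = ≤n
  ... | no ≰n with FinP.pigeonhole (ℕP.≰⇒> ≰n) (lookup xs)
  ...   | i , j , i<j , xsᵢ≡xsⱼ = contradiction xsᵢ≡xsⱼ (lookup-distinct xs uniq i<j)
    where
    lookup-distinct : ∀ xs → Unique xs → ∀ {i j} → i < j → lookup xs i ≢ lookup xs j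
    lookup-distinct (x ∷ xs) (x∉xs ∷ _)    {Fin.zero}  {Fin.suc j} _         = All.lookup x∉xs (∈-lookup j)
    lookup-distinct (x ∷ xs) (_ ∷ uniq)    {Fin.suc i} {Fin.suc j} (s≤s i<j) = lookup-distinct xs uniq i<j

  -- A simple path has at most n vertices, so a bounded search decides its existence.
  simplePath? : ∀ {R : Rel (Fin n) 0ℓ} → Decidable R → Decidable (SimplePath R)
  simplePath? {R} R? u v =
    map′ (λ (xs , _ , path) → xs , path)
         (λ (xs , rs , uniq , ends) → xs , ℕP.≤-trans (ℕP.n≤1+n _) (unique⇒length≤ uniq) , rs , uniq , ends)
         (boundedSearch n _ (λ xs → Linked.linked? R? (u ∷ xs) ×-dec unique? (u ∷ xs) ×-dec endsAt u xs FinP.≟ v))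

  Avoiding : Rel (Fin n) 0ℓ → Fin n → Rel (Fin n) 0ℓ
  Avoiding R z x y = R x y × x ≢ z × y ≢ z

  linked⇒star-avoiding : ∀ {R} z u xs → Linked R (u ∷ xs) → All (z ≢_) (u ∷ xs) →
                         Star (Avoiding R z) u (endsAt u xs)
  linked⇒star-avoiding z u []       _        _                 = ε
  linked⇒star-avoiding z u (x ∷ xs) (r ∷ rs) (z≢u ∷ z≢x ∷ z∉) =
    (r , ≡.≢-sym z≢u , ≡.≢-sym z≢x) ◅ linked⇒star-avoiding z x xs rs (z≢x ∷ z∉)

  simplePath-telescope : ∀ {g} {R : Rel (Fin n) 0ℓ} (Good : Rel (Fin n) g) →
    Reflexive Good → Transitive Good → ∀ {s e} →
    (∀ {c d} → R c d → Star (Avoiding R d) s c → Star (Avoiding R c) d e → Good c d) →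
    SimplePath R s e → Good s e
  simplePath-telescope {R = R} Good good-refl good-trans {s} {e} good-step (xs , rs , uniq , ends) =
    go s xs ε rs uniq ends
    where
    AvoidingAll : List (Fin n) → Rel (Fin n) 0ℓ
    AvoidingAll ys x y = R x y × x ∉ ys × y ∉ ys
    go : ∀ c ys → Star (AvoidingAll ys) s c →
         Linked R (c ∷ ys) → Unique (c ∷ ys) → endsAt c ys ≡ e → Good c e
    go c []       _      _        _                            ≡.refl = good-refl
    go c (b ∷ zs) before (r ∷ rs) (c∉bzs ∷ uniq@(b∉zs′ ∷ _)) ends =
      good-trans (good-step r before-avoiding-b after) (go b zs before′ rs uniq ends)
      where
      c∉zs : c ∉ zs
      c∉zs = All¬⇒¬Any (All.tail c∉bzs)
      b∉zs : b ∉ zs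
      b∉zs = All¬⇒¬Any b∉zs′
      before-avoiding-b : Star (Avoiding R b) s c
      before-avoiding-b = Star.map (λ (r , x∉ , y∉) → r , x∉ ∘ here , y∉ ∘ here) before
      after : Star (Avoiding R c) b e
      after = ≡.subst (Star (Avoiding R c) b) ends (linked⇒star-avoiding c b zs rs c∉bzs)
      before′ : Star (AvoidingAll zs) s b
      before′ = Star.map (λ (r , x∉ , y∉) → r , x∉ ∘ there , y∉ ∘ there) before
                ◅◅ (r , c∉zs , b∉zs) ◅ ε

module TieredGraph {n m : ℕ} (t : Fin n → Fin m) where
  open import Relation.Binary.Construct.Closure.ReflexiveTransitive using (ε; _◅_; _◅◅_)
  open Tiered t
  open LexicographicEdgeOrder {n}
  open Paths t

  isEdge-dec : Decidable IsEdge
  isEdge-dec x y = x Fin.<? y ×-dec t x Fin.<? t y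

  isEdge?⇒IsEdge : ∀ {x y} → isEdge? x y ≡ true → IsEdge x y
  isEdge?⇒IsEdge = does≡true⇒ (isEdge-dec _ _)

  IsEdge⇒isEdge? : ∀ {x y} → IsEdge x y → isEdge? x y ≡ true
  IsEdge⇒isEdge? = dec-true (isEdge-dec _ _)

  inSub? : ∀ S → Decidable (InSub S)
  inSub? S x y = isEdge-dec x y ×-dec S x y Bool.≟ true

  inComplement? : ∀ S → Decidable (InComplement S)
  inComplement? S x y = isEdge-dec x y ×-dec S x y Bool.≟ false

  adj? : ∀ {E : Rel (Fin n) 0ℓ} → Decidable E → Decidable (Adj E)
  adj? E? x y = E? x y ⊎-dec E? y x

  Adj-sym : ∀ {E : Rel (Fin n) 0ℓ} {x y} → Adj E x y → Adj E y x
  Adj-sym = Sum.swap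

  Adj-map : ∀ {E E′ : Rel (Fin n) 0ℓ} → (∀ {x y} → E x y → E′ x y) →
            ∀ {x y} → Adj E x y → Adj E′ x y
  Adj-map f = Sum.map f f

  edgeAbove? : ∀ i j → Decidable (EdgeAbove i j)
  edgeAbove? i j = undirected? (<ₗₑₓ-dec (i , j))

  edgesOf : Subgraph → Subgraph
  edgesOf S x y = isEdge? x y ∧ S x y

  edgesOf-idem : ∀ S x y → edgesOf (edgesOf S) x y ≡ edgesOf S x y
  edgesOf-idem S x y with isEdge? x y
  ... | true  = ≡.refl
  ... | false = ≡.refl

  edgesOf-[]≔false : ∀ S a b x y → (edgesOf S [ a , b ]≔ false) x y ≡ edgesOf (S [ a , b ]≔ false) x y
  edgesOf-[]≔false S a b x y with (x , y) ≟² (a , b)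
  ... | yes _ = ≡.sym (BoolP.∧-zeroʳ (isEdge? x y))
  ... | no  _ = ≡.refl

  connected-reroute : ∀ {E E′ : Rel (Fin n) 0ℓ} → Connected E →
                      (∀ {x y} → E x y → Star (Adj E′) x y) → Connected E′
  connected-reroute {E} {E′} connected route u v = star⇒walk (walk⇒star (connected u v) Star.>>= route-adj)
    where
    route-adj : ∀ {x y} → Adj E x y → Star (Adj E′) x y
    route-adj (inj₁ e) = route e
    route-adj (inj₂ e) = Star.reverse (Adj-sym {E′}) (route e)

  SameEdge : Fin n → Fin n → Rel (Fin n) 0ℓ
  SameEdge a b x y = (x ≡ a × y ≡ b) ⊎ (x ≡ b × y ≡ a)

  SameEdge-flip : ∀ {a b c d} → SameEdge c d a b → SameEdge a b c d
  SameEdge-flip (inj₁ (a≡c , b≡d)) = inj₁ (≡.sym a≡c , ≡.sym b≡d)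
  SameEdge-flip (inj₂ (a≡d , b≡c)) = inj₂ (≡.sym b≡c , ≡.sym a≡d)

  EdgeAbove⇒¬SameEdge : ∀ {i j c d} → EdgeAbove i j c d → ¬ SameEdge c d i j
  EdgeAbove⇒¬SameEdge (inj₁ (_   , cd>cd)) (inj₁ (≡.refl , ≡.refl)) = <ₗₑₓ-irrefl cd>cd
  EdgeAbove⇒¬SameEdge (inj₁ (c<d , cd>dc)) (inj₂ (≡.refl , ≡.refl)) = <ₗₑₓ-asym cd>dc (inj₁ c<d)
  EdgeAbove⇒¬SameEdge (inj₂ (d<c , dc>cd)) (inj₁ (≡.refl , ≡.refl)) = <ₗₑₓ-asym dc>cd (inj₁ d<c)
  EdgeAbove⇒¬SameEdge (inj₂ (_   , dc>dc)) (inj₂ (≡.refl , ≡.refl)) = <ₗₑₓ-irrefl dc>dc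

  OffEdge : Rel (Fin n) 0ℓ → Fin n → Fin n → Rel (Fin n) 0ℓ
  OffEdge E a b x y = E x y × ¬ SameEdge a b x y

  module _ {E : Rel (Fin n) 0ℓ} (E-sym : ∀ {x y} → E x y → E y x) where

    OffEdge-reverse : ∀ {a b x y} → Star (OffEdge E a b) x y → Star (OffEdge E b a) y x
    OffEdge-reverse = Star.reverse (λ (e , ¬same) → E-sym e , ¬same ∘ Sum.map swap swap)

    cycle-detour : ∀ {a b c d} → E a b → ¬ SameEdge c d a b →
                   Star (Avoiding E d) a c → Star (Avoiding E c) d b → Star (OffEdge E c d) c d
    cycle-detour eab ¬same before after =
      Star.reverse avoiding-d before ◅◅ (eab , ¬same) ◅ Star.reverse avoiding-c after
      where
      avoiding-d : ∀ {c d x y} → Avoiding E d x y → OffEdge E c d y x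
      avoiding-d (e , x≢d , y≢d) =
        E-sym e , λ { (inj₁ (_ , x≡d)) → x≢d x≡d ; (inj₂ (y≡d , _)) → y≢d y≡d }
      avoiding-c : ∀ {c d x y} → Avoiding E c x y → OffEdge E c d y x
      avoiding-c (e , x≢c , y≢c) =
        E-sym e , λ { (inj₁ (y≡c , _)) → y≢c y≡c ; (inj₂ (_ , x≡c)) → x≢c x≡c }

  slim-remove : ∀ {S} → Slim S → ∀ a b → Slim (S [ a , b ]≔ false)
  slim-remove {S} slim a b = connected-reroute slim λ (e , Sxy) →
    inj₁ (e , []≔-preserves S (_≡ false) ≡.refl Sxy) ◅ ε

  slim-add : ∀ {S} → Slim S → ∀ {p q} → Star (OffEdge (Adj (InComplement S)) p q) p q →
             Slim (S [ p , q ]≔ true)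
  slim-add {S} slim {p} {q} detour = connected-reroute slim reroute
    where
    S′ = S [ p , q ]≔ true
    keep : ∀ {x y} → InComplement S x y → (x , y) ≢ (p , q) → InComplement S′ x y
    keep (e , Sxy) xy≢pq = e , ≡.trans ([]≔-other S xy≢pq) Sxy
    keep-off : ∀ {x y} → OffEdge (Adj (InComplement S)) p q x y → Adj (InComplement S′) x y
    keep-off (inj₁ g , ¬same) = inj₁ (keep g λ { ≡.refl → ¬same (inj₁ (≡.refl , ≡.refl)) })
    keep-off (inj₂ g , ¬same) = inj₂ (keep g λ { ≡.refl → ¬same (inj₂ (≡.refl , ≡.refl)) })
    reroute : ∀ {x y} → InComplement S x y → Star (Adj (InComplement S′)) x y
    reroute {x} {y} g with (x , y) ≟² (p , q)
    ... | yes ≡.refl = Star.map keep-off detour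
    ... | no  xy≢pq  = inj₁ (keep g xy≢pq) ◅ ε

  complementOfTact-slim : ∀ {T S} → IsComplementOfTact T S → Slim S
  complementOfTact-slim {T} {S} isS = connected-reroute connected λ (e , Txy) → inj₁ (e , S≡false e Txy) ◅ ε
    where
    open SpanningTree T
    S≡false : ∀ {x y} → IsEdge x y → tree x y ≡ true → S x y ≡ false
    S≡false {x} {y} _ Txy = BoolP.¬-not λ Sxy → BoolP.not-¬ Txy (proj₁ (proj₂ (proj₁ (isS x y) Sxy)))

module MaximalSpanningTree {n m : ℕ} (t : Fin n → Fin m)
                           (H : Tiered.Subgraph t) (slim : Tiered.Slim t H) where
  open import Relation.Binary.Construct.Closure.ReflexiveTransitive using (ε; _◅_; _◅◅_)
  open Tiered t
  open LexicographicEdgeOrder {n}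
  open Paths t
  open TieredGraph t

  G∖H : Rel (Fin n) 0ℓ
  G∖H = InComplement H

  Above : Rel (Fin n) 0ℓ → Fin n → Fin n → Rel (Fin n) 0ℓ
  Above E i j x y = Adj E x y × EdgeAbove i j x y

  above? : ∀ {E} → Decidable E → ∀ i j → Decidable (Above E i j)
  above? E? i j x y = adj? E? x y ×-dec edgeAbove? i j x y

  -- The spanning tree Kruskal's algorithm builds from the lexicographically largest edge
  -- down: it keeps exactly the edges of G∖H that are not the smallest edge of a cycle.
  InT : Rel (Fin n) 0ℓ
  InT a b = G∖H a b × ¬ SimplePath (Above G∖H a b) a b

  inT? : Decidable InT
  inT? a b = inComplement? H a b ×-dec ¬? (simplePath? (above? (inComplement? H) a b) a b)

  T : Subgraph
  T a b = does (inT? a b)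

  T⇒InT : ∀ {a b} → InSub T a b → InT a b
  T⇒InT {a} {b} = does≡true⇒ (inT? a b) ∘ proj₂

  T⊆G∖H : ∀ {a b} → InSub T a b → G∖H a b
  T⊆G∖H = proj₁ ∘ T⇒InT

  ¬T⇒cycle : ∀ {a b} → G∖H a b → T a b ≡ false → SimplePath (Above G∖H a b) a b
  ¬T⇒cycle {a} {b} gab Tab≡false = decidable-stable (simplePath? (above? (inComplement? H) a b) a b)
    (λ ¬cycle → does≡false⇒ (inT? a b) Tab≡false (gab , ¬cycle))

  TreeAbove : (Fin n × Fin n → Set) → Rel (Fin n) 0ℓ
  TreeAbove Q x y = Adj (InSub T) x y × Undirected Q x y

  TreeAbove-reverse : ∀ Q {x y} → Star (TreeAbove Q) x y → Star (TreeAbove Q) y x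
  TreeAbove-reverse Q = Star.reverse (λ (adj , q) → Adj-sym {InSub T} adj , Undirected-sym {Q} q)

  G∖H-edge⇒T-walk : ∀ {Q} → (∀ {e e′} → Q e → e <ₗₑₓ e′ → Q e′) →
                    ∀ {x y} → Adj G∖H x y → Undirected Q x y → Star (TreeAbove Q) x y
  G∖H-edge⇒T-walk {Q} upward (inj₁ gxy) q =
    oriented (>ₗₑₓ-wellFounded _) gxy (Undirected-ordered {Q} (proj₁ (proj₁ gxy)) q)
    where
    oriented : ∀ {a b} → Acc (flip _<ₗₑₓ_) (a , b) → G∖H a b → Q (a , b) → Star (TreeAbove Q) a b
    oriented {a} {b} (acc above-ab) gab q with T a b in Tab
    ... | true  = (inj₁ (proj₁ gab , Tab) , inj₁ (proj₁ (proj₁ gab) , q)) ◅ ε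
    ... | false = simplePath⇒star (¬T⇒cycle gab Tab) Star.>>= step
      where
      step : ∀ {x y} → Above G∖H a b x y → Star (TreeAbove Q) x y
      step (inj₁ gxy , above) = oriented (above-ab ab<xy) gxy (upward q ab<xy)
        where ab<xy = Undirected-ordered {(a , b) <ₗₑₓ_} (proj₁ (proj₁ gxy)) above
      step (inj₂ gyx , above) = TreeAbove-reverse Q (oriented (above-ab ab<yx) gyx (upward q ab<yx))
        where ab<yx = Undirected-ordered {(a , b) <ₗₑₓ_} (proj₁ (proj₁ gyx))
                        (Undirected-sym {(a , b) <ₗₑₓ_} above)
  G∖H-edge⇒T-walk {Q} upward (inj₂ gyx) q =
    TreeAbove-reverse Q (G∖H-edge⇒T-walk upward (inj₁ gyx) (Undirected-sym {Q} q))

  T-connected : Connected (InSub T)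
  T-connected = connected-reroute slim λ gxy →
    Star.map proj₁ (G∖H-edge⇒T-walk {λ _ → ⊤} (λ _ _ → tt) (inj₁ gxy) (inj₁ (proj₁ (proj₁ gxy) , tt)))

  G∖H-walk⇒T-walk : ∀ {i j u v} → Star (Above G∖H i j) u v → Star (Above (InSub T) i j) u v
  G∖H-walk⇒T-walk {i} {j} walk =
    walk Star.>>= λ (adj , above) → G∖H-edge⇒T-walk {(i , j) <ₗₑₓ_} (<ₗₑₓ-trans) adj above

  Detour : Rel (Fin n) 0ℓ
  Detour a b = Star (OffEdge (Adj (InSub T)) a b) a b

  -- By descent along the lexicographic order: a detour around a tree edge ab either stays
  -- above ab, so ab would close a cycle of G∖H above it, or uses a smaller tree edge cd,
  -- and then the detour together with ab is a detour around cd.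
  no-detour : ∀ {a b} → InSub T a b → ¬ Detour a b
  no-detour {a} {b} = go (<ₗₑₓ-wellFounded (a , b))
    where
    go : ∀ {a b} → Acc _<ₗₑₓ_ (a , b) → InSub T a b → ¬ Detour a b
    go {a} {b} (acc below-ab) Tab detour =
      finish (simplePath-telescope Good (inj₁ ε) good-trans step (star⇒simplePath detour))
      where
      R = OffEdge (Adj (InSub T)) a b
      SmallerDetour : Set
      SmallerDetour = ∃₂ λ c d → InSub T c d × (c , d) <ₗₑₓ (a , b) × Detour c d
      Good : Rel (Fin n) 0ℓ
      Good x y = Star (Above (InSub T) a b) x y ⊎ SmallerDetour
      good-trans : Transitive Good
      good-trans (inj₁ w) (inj₁ w′) = inj₁ (w ◅◅ w′)
      good-trans (inj₁ _) (inj₂ s)  = inj₂ s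
      good-trans (inj₂ s) _         = inj₂ s
      step : ∀ {c d} → R c d → Star (Avoiding R d) a c → Star (Avoiding R c) d b → Good c d
      step {c} {d} (adj , ¬same) before after = compare adj
        where
        forget : ∀ {z x y} → Avoiding R z x y → Avoiding (Adj (InSub T)) z x y
        forget ((adj , _) , x≢z , y≢z) = adj , x≢z , y≢z
        detour-cd : Detour c d
        detour-cd = cycle-detour (Adj-sym {InSub T}) (inj₁ Tab) (¬same ∘ SameEdge-flip)
                      (Star.map forget before) (Star.map forget after)
        compare : Adj (InSub T) c d → Good c d
        compare (inj₁ Tcd) with <ₗₑₓ-cmp (c , d) (a , b)
        ... | tri< cd<ab _ _ = inj₂ (c , d , Tcd , cd<ab , detour-cd)
        ... | tri≈ _ cd≡ab _ = contradiction (inj₁ cd≡ab) ¬same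
        ... | tri> _ _ ab<cd = inj₁ ((inj₁ Tcd , inj₁ (proj₁ (proj₁ Tcd) , ab<cd)) ◅ ε)
        compare (inj₂ Tdc) with <ₗₑₓ-cmp (d , c) (a , b)
        ... | tri< dc<ab _ _ = inj₂ (d , c , Tdc , dc<ab , OffEdge-reverse (Adj-sym {InSub T}) detour-cd)
        ... | tri≈ _ dc≡ab _ = contradiction (inj₂ (swap dc≡ab)) ¬same
        ... | tri> _ _ ab<dc = inj₁ ((inj₂ Tdc , inj₂ (proj₁ (proj₁ Tdc) , ab<dc)) ◅ ε)
      finish : ¬ Good a b
      finish (inj₁ above) = proj₂ (T⇒InT Tab) (star⇒simplePath (Star.map T-above⇒G∖H-above above))
        where
        T-above⇒G∖H-above : ∀ {x y} → Above (InSub T) a b x y → Above G∖H a b x y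
        T-above⇒G∖H-above (adj , ab<xy) = Adj-map {InSub T} T⊆G∖H adj , ab<xy
      finish (inj₂ (c , d , Tcd , cd<ab , detour)) = go (below-ab cd<ab) Tcd detour

  T-acyclic : Acyclic (InSub T)
  T-acyclic (u , []          , _        , _                  , ()      , _)
  T-acyclic (u , _ ∷ []      , _        , _                  , s≤s () , _)
  T-acyclic (u , x ∷ y ∷ ys , r ∷ rs , u∉ ∷ (x∉ ∷ _) , _ , closing) = close closing
    where
    w = endsAt y ys
    x≢w : x ≢ w
    x≢w = All.lookup x∉ (endsAt-∈ y ys)
    around : Star (OffEdge (Adj (InSub T)) u w) u w
    around = (r , λ { (inj₁ (_ , x≡w)) → x≢w x≡w ; (inj₂ (_ , x≡u)) → All.head u∉ (≡.sym x≡u) })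
           ◅ Star.map avoiding-u (linked⇒star-avoiding u x (y ∷ ys) rs u∉)
      where
      avoiding-u : ∀ {p q} → Avoiding (Adj (InSub T)) u p q → OffEdge (Adj (InSub T)) u w p q
      avoiding-u (adj , p≢u , q≢u) =
        adj , λ { (inj₁ (p≡u , _)) → p≢u p≡u ; (inj₂ (_ , q≡u)) → q≢u q≡u }
    close : ¬ Adj (InSub T) w u
    close (inj₁ Twu) = no-detour Twu (OffEdge-reverse (Adj-sym {InSub T}) around)
    close (inj₂ Tuw) = no-detour Tuw around

  tree : SpanningTree
  tree = record { tree = T ; connected = T-connected ; acyclic = T-acyclic }

  externallyActive? : Decidable (ExternallyActive tree)
  externallyActive? i j =
    isEdge-dec i j ×-dec T i j Bool.≟ false ×-dec simplePath? (above? (inSub? T) i j) i j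

  ActiveEdge : Set
  ActiveEdge = ∃₂ λ i j → InSub H i j × ExternallyActive tree i j

  activeEdge? : Dec ActiveEdge
  activeEdge? = FinP.any? λ i → FinP.any? λ j → inSub? H i j ×-dec externallyActive? i j

  -- An edge of G∖H outside T closes a cycle of G∖H above it, which T re-routes above it:
  -- the edge is externally active.
  ¬ActiveEdge⇒complementOfTact : ¬ ActiveEdge → IsComplementOfTact tree (edgesOf H)
  ¬ActiveEdge⇒complementOfTact ¬active i j = inH⇒outside , outside⇒inH
    where
    inH⇒outside : edgesOf H i j ≡ true → IsEdge i j × T i j ≡ false × ¬ ExternallyActive tree i j
    inH⇒outside e = ij , BoolP.¬-not (λ Tij → BoolP.not-¬ Hij (proj₂ (T⊆G∖H (ij , Tij))))
                       , λ active → ¬active (i , j , (ij , Hij) , active)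
      where
      ij = isEdge?⇒IsEdge (BoolP.∧-conicalˡ _ _ e)
      Hij = BoolP.∧-conicalʳ _ _ e
    outside⇒inH : IsEdge i j × T i j ≡ false × ¬ ExternallyActive tree i j → edgesOf H i j ≡ true
    outside⇒inH (ij , Tij , inactive) = ≡.cong₂ _∧_ (IsEdge⇒isEdge? ij) (BoolP.¬-not λ Hij →
      inactive (ij , Tij , star⇒simplePath (G∖H-walk⇒T-walk (simplePath⇒star (¬T⇒cycle (ij , Hij) Tij)))))

  exchange-slim : ∀ {i j c d p q} → IsEdge i j → EdgeAbove i j c d →
    Star (Avoiding (Above (InSub T) i j) d) i c → Star (Avoiding (Above (InSub T) i j) c) d j →
    SameEdge c d p q → Slim (H [ i , j ]≔ false [ p , q ]≔ true)
  exchange-slim {i} {j} {c} {d} ij above before after same =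
    slim-add (slim-remove slim i j) (orient same)
    where
    H₀ = H [ i , j ]≔ false
    E = Adj (InComplement H₀)
    forget : ∀ {z x y} → Avoiding (Above (InSub T) i j) z x y → Avoiding E z x y
    forget ((adj , _) , x≢z , y≢z) = Adj-map {InSub T} T⊆G∖H₀ adj , x≢z , y≢z
      where
      T⊆G∖H₀ : ∀ {x y} → InSub T x y → InComplement H₀ x y
      T⊆G∖H₀ Txy = let (e , Hxy) = T⊆G∖H Txy in e , []≔-preserves H (_≡ false) ≡.refl Hxy
    detour : Star (OffEdge E c d) c d
    detour = cycle-detour (Adj-sym {InComplement H₀}) (inj₁ (ij , []≔-updated H))
               (EdgeAbove⇒¬SameEdge above) (Star.map forget before) (Star.map forget after)
    orient : ∀ {p q} → SameEdge c d p q → Star (OffEdge E p q) p q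
    orient (inj₁ (≡.refl , ≡.refl)) = detour
    orient (inj₂ (≡.refl , ≡.refl)) = OffEdge-reverse (Adj-sym {InComplement H₀}) detour

module EdgeProducts {n m : ℕ} (t : Fin n → Fin m) {c ℓ} (M : CommutativeMonoid c ℓ) where
  open Tiered t
  open TieredGraph t
  open CommutativeMonoid M
  open CommutativeMonoidProduct M

  ∏-edges-extract : ∀ w {S a b} → IsEdge a b → S a b ≡ true →
                    ∏[ edgesOf S ] w ≈ w a b ∙ ∏[ edgesOf (S [ a , b ]≔ false) ] w
  ∏-edges-extract w {S} {a} {b} ab Sab = trans (∏[]-extract w (≡.cong₂ _∧_ (IsEdge⇒isEdge? ab) Sab))
    (reflexive (≡.cong (w a b ∙_) (∏[]-cong w (edgesOf-[]≔false S a b))))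

  ∏-edges-add : ∀ w {S a b} → IsEdge a b → S a b ≡ false →
                ∏[ edgesOf (S [ a , b ]≔ true) ] w ≈ w a b ∙ ∏[ edgesOf S ] w
  ∏-edges-add w {S} {a} {b} ab Sab = trans (∏-edges-extract w ab ([]≔-updated S))
    (reflexive (≡.cong (w a b ∙_) (∏[]-cong w λ x y →
      ≡.cong (isEdge? x y ∧_) ([]≔-restore S Sab))))

module ActiveSpan {c ℓ} (K : Field c ℓ) {n m : ℕ} (t : Fin n → Fin m) where
  open Field K
  open Poly K n
  open PolynomialArithmetic K n
  open Tiered t
  open TieredGraph t
  open Paths t
  open LexicographicEdgeOrder {n}
  module ∏P = CommutativeMonoidProduct *P-commutativeMonoid
  module ∑ℕ = CommutativeMonoidProduct ℕP.+-0-commutativeMonoid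
  open EdgeProducts t using (∏-edges-extract; ∏-edges-add)

  Z-extract : ∀ {S a b} → IsEdge a b → S a b ≡ true →
              Z K S ≈P varDiff a b *P Z K (S [ a , b ]≔ false)
  Z-extract = ∏-edges-extract *P-commutativeMonoid varDiff

  Z-add : ∀ {S a b} → IsEdge a b → S a b ≡ false →
          Z K (S [ a , b ]≔ true) ≈P varDiff a b *P Z K S
  Z-add = ∏-edges-add *P-commutativeMonoid varDiff

  weight : Subgraph → ℕ
  weight S = ∑ℕ.∏[ edgesOf S ] λ x y → rank (x , y)

  weight-extract : ∀ {S a b} → IsEdge a b → S a b ≡ true →
                   weight S ≡ rank (a , b) ℕ.+ weight (S [ a , b ]≔ false)
  weight-extract = ∏-edges-extract ℕP.+-0-commutativeMonoid _

  weight-add : ∀ {S a b} → IsEdge a b → S a b ≡ false →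
               weight (S [ a , b ]≔ true) ≡ rank (a , b) ℕ.+ weight S
  weight-add = ∏-edges-add ℕP.+-0-commutativeMonoid _

  maxWeight : ℕ
  maxWeight = ∑ℕ.∏ λ x y → rank (x , y)

  weight≤maxWeight : ∀ S → weight S ℕ.≤ maxWeight
  weight≤maxWeight S =
    ≡.subst₂ ℕ._≤_ (≡.sym (∑ℕ.∏-grid term)) (≡.sym (∑ℕ.∏-grid λ x y → rank (x , y)))
      (termwise (cartesianProduct (allFin n) (allFin n)))
    where
    term : Fin n → Fin n → ℕ
    term x y = if edgesOf S x y then rank (x , y) else 0
    term≤rank : ∀ x y → term x y ℕ.≤ rank (x , y)
    term≤rank x y with edgesOf S x y
    ... | true  = ℕP.≤-refl
    ... | false = z≤n
    termwise : ∀ ps → ∑ℕ.product (map (uncurry term) ps)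
                      ℕ.≤ ∑ℕ.product (map (uncurry λ x y → rank (x , y)) ps)
    termwise []             = z≤n
    termwise ((x , y) ∷ ps) = ℕP.+-mono-≤ (term≤rank x y) (termwise ps)

  actGenerator : ActGen → Pol
  actGenerator g = Z K (ActGen.S g)

  module _ (S : Subgraph) (slimS : Slim S) where
    open MaximalSpanningTree t S slimS

    inactive⇒inActSpan : ¬ ActiveEdge → InActSpan K (Z K S)
    inactive⇒inActSpan ¬active =
      InSpan-resp actGenerator {Z K (edgesOf S)} {Z K S} (InSpan-gen actGenerator generator)
        (≡⇒≈P {Z K (edgesOf S)} (∏P.∏[]-cong varDiff (edgesOf-idem S)))
      where
      generator : ActGen
      generator = record { T = tree ; S = edgesOf S ; isS = ¬ActiveEdge⇒complementOfTact ¬active }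

    active⇒inActSpan : ActiveEdge →
      (∀ S′ → Slim S′ → weight S ℕ.< weight S′ → InActSpan K (Z K S′)) → InActSpan K (Z K S)
    active⇒inActSpan (i , j , (ij , Sij) , _ , _ , path) heavier⇒inActSpan =
      InSpan-resp actGenerator {varDiff i j *P X} {Z K S}
        (simplePath-telescope Good good-refl good-trans step path)
        (≈P-sym {Z K S} {varDiff i j *P X} (Z-extract {S} ij Sij))
      where
      S₀ = S [ i , j ]≔ false
      X = Z K S₀
      R = Above (InSub T) i j

      Good : Rel (Fin n) (c ⊔ ℓ)
      Good x y = InActSpan K (varDiff x y *P X)

      good-refl : Reflexive Good
      good-refl {x} = InSpan-zero actGenerator {varDiff x x *P X} (varDiff-self-*P x X)

      good-trans : Transitive Good
      good-trans {x} {y} {z} gxy gyz =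
        InSpan-resp actGenerator {(varDiff x y *P X) +P (varDiff y z *P X)} {varDiff x z *P X}
          (InSpan-+ actGenerator {varDiff x y *P X} {varDiff y z *P X} gxy gyz) (varDiff-trans-*P x y z X)

      exchange : ∀ {p q} → InSub T p q → (i , j) <ₗₑₓ (p , q) → Slim (S₀ [ p , q ]≔ true) → Good p q
      exchange {p} {q} (pq , Tpq) ij<pq slim′ =
        InSpan-resp actGenerator {Z K (S₀ [ p , q ]≔ true)} {varDiff p q *P X}
          (heavier⇒inActSpan (S₀ [ p , q ]≔ true) slim′ heavier) (Z-add {S₀} pq S₀pq)
        where
        S₀pq : S₀ p q ≡ false
        S₀pq = []≔-preserves S (_≡ false) ≡.refl (proj₂ (T⊆G∖H (pq , Tpq)))
        heavier : weight S ℕ.< weight (S₀ [ p , q ]≔ true)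
        heavier = begin-strict
          weight S                    ≡⟨ weight-extract ij Sij ⟩
          rank (i , j) ℕ.+ weight S₀  <⟨ ℕP.+-monoˡ-< (weight S₀) (rank-mono ij<pq) ⟩
          rank (p , q) ℕ.+ weight S₀  ≡⟨ weight-add pq S₀pq ⟨
          weight (S₀ [ p , q ]≔ true) ∎
          where open ℕP.≤-Reasoning

      step : ∀ {c d} → R c d → Star (Avoiding R d) i c → Star (Avoiding R c) d j → Good c d
      step (inj₁ Tcd , above) before after =
        exchange Tcd (Undirected-ordered {(i , j) <ₗₑₓ_} (proj₁ (proj₁ Tcd)) above)
          (exchange-slim ij above before after (inj₁ (≡.refl , ≡.refl)))
      step {c} {d} (inj₂ Tdc , above) before after =
        InSpan-resp actGenerator {(- 1#) ·P (varDiff d c *P X)} {varDiff c d *P X}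
          (InSpan-· actGenerator (- 1#) {varDiff d c *P X} good-dc) (varDiff-swap-*P c d X)
        where
        ij<dc = Undirected-ordered {(i , j) <ₗₑₓ_} (proj₁ (proj₁ Tdc))
                  (Undirected-sym {(i , j) <ₗₑₓ_} above)
        good-dc : Good d c
        good-dc = exchange Tdc ij<dc (exchange-slim ij above before after (inj₂ (≡.refl , ≡.refl)))

  slim⇒inActSpan : ∀ S → Slim S → InActSpan K (Z K S)
  slim⇒inActSpan S slimS = go S slimS (ℕInd.<-wellFounded (maxWeight ∸ weight S))
    where
    go : ∀ S → Slim S → Acc ℕ._<_ (maxWeight ∸ weight S) → InActSpan K (Z K S)
    go S slimS (acc lighter) with MaximalSpanningTree.activeEdge? t S slimS
    ... | no  ¬active = inactive⇒inActSpan S slimS ¬active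
    ... | yes active  = active⇒inActSpan S slimS active λ S′ slim′ S<S′ →
                          go S′ slim′ (lighter (ℕP.∸-monoʳ-< S<S′ (weight≤maxWeight S′)))

  actGenerator-inSG : ∀ g → InSG K (actGenerator g)
  actGenerator-inSG g =
    InSpan-gen (λ h → Z K (proj₁ h)) (ActGen.S g , complementOfTact-slim {ActGen.T g} (ActGen.isS g))

mainTheorem2 : ∀ {c ℓ} (K : Field c ℓ) (n m : ℕ) (t : Fin n → Fin m)
    → (∀ k → ∃ λ v → t v ≡ k)
    → (∀ (g : Tiered.ActGen t) → Tiered.InSG t K (Tiered.Z t K (Tiered.ActGen.S g)))
      × (∀ (h : Tiered.SlimSubgraph t) → Tiered.InActSpan t K (Tiered.Z t K (proj₁ h)))
mainTheorem2 K n m t _ = actGenerator-inSG , λ (S , slimS) → slim⇒inActSpan S slimS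
  where open ActiveSpan K t
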